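{- For every $d\le 15$, the cube $Q^d$ is stackable.
   Context: $Q^d$ has vertex set $\{0,1\}^d$, adjacency meaning differing in exactly one coordinate. A configuration is a function $C:V\to\mathbb{N}$ (numbers of cups); a cup stacking move from $u$ to $v$ is allowed when $C(u)\ge1$, $C(v)\ge1$ and $\mathrm{dist}(u,v)=C(u)$, and moves all cups of $u$ onto $v$. A graph is stackable if for every vertex $r$, starting with one cup on every vertex, some sequence of moves puts all cups on $r$. -}

module Defs where

open import Data.Nat using (ℕ; zero; suc; _+_; _≥_)
open import Data.Bool using (Bool; true; false)
open import Data.Vec using (Vec; []; _∷_)
open import Data.Product using (Σ; ∃; _×_; _,_)
open import Relation.Binary.PropositionalEquality using (_≡_; _≢_)
open import Relation.Binary.Construct.Closure.ReflexiveTransitive using (Star)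

Vertex : ℕ → Set
Vertex d = Vec Bool d

-- Distance in Q^d (graph distance = number of differing coordinates, Hamming distance)
dist : ∀ {d} → Vertex d → Vertex d → ℕ
dist [] [] = 0
dist (true ∷ xs) (true ∷ ys) = dist xs ys
dist (false ∷ xs) (false ∷ ys) = dist xs ys
dist (true ∷ xs) (false ∷ ys) = suc (dist xs ys)
dist (false ∷ xs) (true ∷ ys) = suc (dist xs ys)

-- Configurations: number of cups on each vertex
Config : ℕ → Set
Config d = Vertex d → ℕ

record MoveFromTo {d : ℕ} (u v : Vertex d) (C C' : Config d) : Set where
  field
    source-nonempty : C u ≥ 1
    target-nonempty : C v ≥ 1
    distance-ok     : dist u v ≡ C u
    source-emptied  : C' u ≡ 0
    target-updated  : C' v ≡ C v + C u
    others-fixed    : ∀ w → w ≢ u → w ≢ v → C' w ≡ C w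

Move : ∀ {d} → Config d → Config d → Set
Move {d} C C' = Σ (Vertex d) λ u → Σ (Vertex d) λ v → MoveFromTo u v C C'

initial : ∀ {d} → Config d
initial _ = 1

AllOn : ∀ {d} → Vertex d → Config d → Set
AllOn {d} r C = ∀ (w : Vertex d) → w ≢ r → C w ≡ 0

Stackable : ℕ → Set
Stackable d = ∀ (r : Vertex d) → ∃ λ (C : Config d) → Star Move initial C × AllOn r C

-- Fix a root r and call a copy of Q^m inside Q^d whose vertex x lies at distance t + |x|
-- from r a cube at height t.  Splitting it along a coordinate gives a cube of dimension
-- m - 1 at height t and one at height t + 1; emptying the lower one onto r does not
-- touch the upper one, so the two can be emptied one after the other.  Base cases are the
-- root itself and a few cubes of dimension at most 5 with explicit cleanup sequences,
-- checked by evaluation; splitting Q^d (at height 0) down to these pieces succeeds for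
-- every d ≤ 15.  Every vertex can serve as the root, as x ↦ r ⊕ x is an isometry of Q^d
-- sending the all-false vertex to r.
module Submission where

open import Defs
open import Data.Bool using (true; false; _xor_; T)
open import Data.Bool.Properties using () renaming (_≟_ to _≟ᵇ_)
open import Data.Empty using (⊥-elim)
open import Data.List using (List; []; _∷_)
open import Data.Maybe using (Maybe; just; nothing; is-just; to-witness-T; _<∣>_)
import Data.Maybe as Maybe
open import Data.Nat using (ℕ; zero; suc; _+_; _≤_; _<_; _≤?_; _%_; _≡ᵇ_; ⌊_/2⌋; z≤n; s≤s)
import Data.Nat as ℕ
open import Data.Nat.Properties using (+-suc; m≤m+n; ≤-trans; allUpTo?)
open import Data.Product using (∃; _×_; _,_)
open import Data.Vec using ([]; _∷_; zipWith)
open import Data.Vec.Properties using (≡-dec)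
open import Function using (_$_)
open import Relation.Binary.Definitions using (DecidableEquality)
open import Relation.Binary.PropositionalEquality
open import Relation.Binary.Construct.Closure.ReflexiveTransitive using (Star; ε; _◅_; _◅◅_)
open import Relation.Nullary using (Dec; yes; no; ¬?; _×-dec_; map′)
open import Relation.Nullary.Decidable using (from-yes; T?; dec⇒maybe)
open import Relation.Unary using (Decidable)

private
  variable
    d m t : ℕ

_≟_ : DecidableEquality (Vertex d)
_≟_ = ≡-dec _≟ᵇ_

weight : Vertex m → ℕ
weight []          = 0
weight (true  ∷ x) = suc (weight x)
weight (false ∷ x) = weight x

dist-refl : (x : Vertex d) → dist x x ≡ 0
dist-refl []          = refl
dist-refl (true  ∷ x) = dist-refl x
dist-refl (false ∷ x) = dist-refl x

dist≡0⇒≡ : (x y : Vertex d) → dist x y ≡ 0 → x ≡ y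
dist≡0⇒≡ []          []          _  = refl
dist≡0⇒≡ (true  ∷ x) (true  ∷ y) eq = cong (true  ∷_) (dist≡0⇒≡ x y eq)
dist≡0⇒≡ (false ∷ x) (false ∷ y) eq = cong (false ∷_) (dist≡0⇒≡ x y eq)

∀-vertex? : {P : Vertex m → Set} → Decidable P → Dec (∀ x → P x)
∀-vertex? {zero}  P? = map′ (λ p → λ { [] → p }) (λ p → p []) (P? [])
∀-vertex? {suc m} P? =
  map′ (λ (p₀ , p₁) → λ { (false ∷ x) → p₀ x ; (true ∷ x) → p₁ x })
       (λ p → (λ x → p (false ∷ x)) , (λ x → p (true ∷ x)))
       (∀-vertex? (λ x → P? (false ∷ x)) ×-dec ∀-vertex? (λ x → P? (true ∷ x)))

_⊕_ : Vertex d → Vertex d → Vertex d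
_⊕_ = zipWith _xor_

⊕-involutive : (r x : Vertex d) → r ⊕ (r ⊕ x) ≡ x
⊕-involutive []          []          = refl
⊕-involutive (false ∷ r) (b     ∷ x) = cong (b ∷_) (⊕-involutive r x)
⊕-involutive (true  ∷ r) (true  ∷ x) = cong (true ∷_) (⊕-involutive r x)
⊕-involutive (true  ∷ r) (false ∷ x) = cong (false ∷_) (⊕-involutive r x)

dist-⊕ : (r x y : Vertex d) → dist (r ⊕ x) (r ⊕ y) ≡ dist x y
dist-⊕ []          []          []          = refl
dist-⊕ (false ∷ r) (false ∷ x) (false ∷ y) = dist-⊕ r x y
dist-⊕ (false ∷ r) (false ∷ x) (true  ∷ y) = cong suc (dist-⊕ r x y)
dist-⊕ (false ∷ r) (true  ∷ x) (false ∷ y) = cong suc (dist-⊕ r x y)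
dist-⊕ (false ∷ r) (true  ∷ x) (true  ∷ y) = dist-⊕ r x y
dist-⊕ (true  ∷ r) (false ∷ x) (false ∷ y) = dist-⊕ r x y
dist-⊕ (true  ∷ r) (false ∷ x) (true  ∷ y) = cong suc (dist-⊕ r x y)
dist-⊕ (true  ∷ r) (true  ∷ x) (false ∷ y) = cong suc (dist-⊕ r x y)
dist-⊕ (true  ∷ r) (true  ∷ x) (true  ∷ y) = dist-⊕ r x y

dist-⊕-self : (r x : Vertex d) → dist (r ⊕ x) r ≡ weight x
dist-⊕-self []          []          = refl
dist-⊕-self (false ∷ r) (false ∷ x) = dist-⊕-self r x
dist-⊕-self (false ∷ r) (true  ∷ x) = cong suc (dist-⊕-self r x)
dist-⊕-self (true  ∷ r) (false ∷ x) = dist-⊕-self r x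
dist-⊕-self (true  ∷ r) (true  ∷ x) = cong suc (dist-⊕-self r x)

stackOnto : Config m → Vertex m → Vertex m → Config m
stackOnto C u v w with w ≟ u | w ≟ v
... | yes _ | _     = 0
... | no _  | yes _ = C v + C u
... | no _  | no _  = C w

stackOnto-source : (C : Config m) (u v : Vertex m) → stackOnto C u v u ≡ 0
stackOnto-source C u v with u ≟ u
... | yes _   = refl
... | no u≢u = ⊥-elim (u≢u refl)

stackOnto-target : (C : Config m) (u v : Vertex m) → v ≢ u → stackOnto C u v v ≡ C v + C u
stackOnto-target C u v v≢u with v ≟ u | v ≟ v
... | yes v≡u | _       = ⊥-elim (v≢u v≡u)
... | no _    | yes _   = refl
... | no _    | no v≢v = ⊥-elim (v≢v refl)

stackOnto-other : (C : Config m) (u v w : Vertex m) → w ≢ u → w ≢ v → stackOnto C u v w ≡ C w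
stackOnto-other C u v w w≢u w≢v with w ≟ u | w ≟ v
... | yes w≡u | _       = ⊥-elim (w≢u w≡u)
... | no _    | yes w≡v = ⊥-elim (w≢v w≡v)
... | no _    | no _    = refl

vacate : Config m → Vertex m → Config m
vacate C u w with w ≟ u
... | yes _ = 0
... | no _  = C w

stack-move : (C : Config d) {u v : Vertex d} → u ≢ v → 1 ≤ C u → 1 ≤ C v → dist u v ≡ C u →
             Move C (stackOnto C u v)
stack-move C {u} {v} u≢v Cu≥1 Cv≥1 dist≡Cu = u , v , record
  { source-nonempty = Cu≥1
  ; target-nonempty = Cv≥1
  ; distance-ok     = dist≡Cu
  ; source-emptied  = stackOnto-source C u v
  ; target-updated  = stackOnto-target C u v (≢-sym u≢v)
  ; others-fixed    = stackOnto-other C u v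
  }

module _ {f : Vertex m → Vertex d} (f-injective : ∀ {x y} → f x ≡ f y → x ≡ y)
         {C : Config d} {L : Config m} (C∘f≗L : ∀ x → C (f x) ≡ L x) where

  stackOnto-image : ∀ a b x → stackOnto C (f a) (f b) (f x) ≡ stackOnto L a b x
  stackOnto-image a b x with x ≟ a | x ≟ b
  ... | yes refl | _        = stackOnto-source C (f x) (f b)
  ... | no x≢a   | yes refl =
    trans (stackOnto-target C (f a) (f x) (λ eq → x≢a (f-injective eq))) (cong₂ _+_ (C∘f≗L x) (C∘f≗L a))
  ... | no x≢a   | no x≢b   =
    trans (stackOnto-other C (f a) (f b) (f x) (λ eq → x≢a (f-injective eq)) (λ eq → x≢b (f-injective eq)))
          (C∘f≗L x)

  stackOnto-image-outside : ∀ {r} → (∀ x → f x ≢ r) → ∀ a x → stackOnto C (f a) r (f x) ≡ vacate L a x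
  stackOnto-image-outside {r} f≢r a x with x ≟ a
  ... | yes refl = stackOnto-source C (f x) r
  ... | no x≢a   = trans (stackOnto-other C (f a) r (f x) (λ eq → x≢a (f-injective eq)) (f≢r x)) (C∘f≗L x)

record Subcube (r : Vertex d) (m t : ℕ) : Set where
  field
    embed           : Vertex m → Vertex d
    embed-isometric : ∀ x y → dist (embed x) (embed y) ≡ dist x y
    dist-embed-root : ∀ x → dist (embed x) r ≡ t + weight x

  embed-injective : ∀ {x y} → embed x ≡ embed y → x ≡ y
  embed-injective {x} {y} eq = dist≡0⇒≡ x y (begin
    dist x y                  ≡⟨ embed-isometric x y ⟨
    dist (embed x) (embed y)  ≡⟨ cong (dist (embed x)) eq ⟨
    dist (embed x) (embed x)  ≡⟨ dist-refl (embed x) ⟩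
    0                         ∎)
    where open ≡-Reasoning

open Subcube

embed≢root : {r : Vertex d} (S : Subcube r m (suc t)) (x : Vertex m) → embed S x ≢ r
embed≢root {r = r} S x eq
  with trans (sym (dist-refl r)) (subst (λ v → dist v r ≡ _) eq (dist-embed-root S x))
... | ()

lowerFace : {r : Vertex d} → Subcube r (suc m) t → Subcube r m t
lowerFace S = record
  { embed           = λ x → embed S (false ∷ x)
  ; embed-isometric = λ x y → embed-isometric S (false ∷ x) (false ∷ y)
  ; dist-embed-root = λ x → dist-embed-root S (false ∷ x)
  }

upperFace : {r : Vertex d} → Subcube r (suc m) t → Subcube r m (suc t)
upperFace {t = t} S = record
  { embed           = λ x → embed S (true ∷ x)
  ; embed-isometric = λ x y → embed-isometric S (true ∷ x) (true ∷ y)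
  ; dist-embed-root = λ x → trans (dist-embed-root S (true ∷ x)) (+-suc t (weight x))
  }

faces-disjoint : {r : Vertex d} (S : Subcube r (suc m) t) (x y : Vertex m) →
                 embed S (true ∷ x) ≢ embed S (false ∷ y)
faces-disjoint S x y eq with embed-injective S eq
... | ()

translation : (r : Vertex d) → Subcube r d 0
translation r = record
  { embed           = r ⊕_
  ; embed-isometric = dist-⊕ r
  ; dist-embed-root = dist-⊕-self r
  }

Outside : {r : Vertex d} → Subcube r m t → Vertex d → Set
Outside S w = ∀ x → w ≢ embed S x

record Tracks {r : Vertex d} (S : Subcube r m t) (C₀ : Config d) (L : Config m) (C : Config d) : Set where
  field
    on-subcube    : ∀ x → C (embed S x) ≡ L x
    off-subcube   : ∀ w → Outside S w → w ≢ r → C w ≡ C₀ w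
    root-occupied : 1 ≤ C r

record Cleared {r : Vertex d} (S : Subcube r m t) (C₀ C : Config d) : Set where
  field
    subcube-emptied : ∀ x → embed S x ≢ r → C (embed S x) ≡ 0
    off-subcube     : ∀ w → Outside S w → w ≢ r → C w ≡ C₀ w
    root-occupied   : 1 ≤ C r

module _ {r : Vertex d} (S : Subcube r m (suc t)) {C₀ : Config d} {L : Config m} {C : Config d}
         (tracks : Tracks S C₀ L C) where
  open Tracks tracks

  step-within : ∀ {a b} → a ≢ b → 1 ≤ L a → 1 ≤ L b → dist a b ≡ L a →
                Move C (stackOnto C (embed S a) (embed S b))
  step-within {a} {b} a≢b La≥1 Lb≥1 dist≡La =
    stack-move C (λ eq → a≢b (embed-injective S eq))
      (subst (1 ≤_) (sym (on-subcube a)) La≥1) (subst (1 ≤_) (sym (on-subcube b)) Lb≥1)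
      (trans (embed-isometric S a b) (trans dist≡La (sym (on-subcube a))))

  step-to-root : ∀ {a} → suc t + weight a ≡ L a → Move C (stackOnto C (embed S a) r)
  step-to-root {a} height≡La =
    stack-move C (embed≢root S a) (subst (1 ≤_) (trans height≡La (sym (on-subcube a))) (s≤s z≤n))
      root-occupied (trans (dist-embed-root S a) (trans height≡La (sym (on-subcube a))))

  tracks-within : ∀ a b → Tracks S C₀ (stackOnto L a b) (stackOnto C (embed S a) (embed S b))
  tracks-within a b = record
    { on-subcube    = stackOnto-image (embed-injective S) on-subcube a b
    ; off-subcube   = λ w out w≢r →
        trans (stackOnto-other C (embed S a) (embed S b) w (out a) (out b)) (off-subcube w out w≢r)
    ; root-occupied =
        subst (1 ≤_) (sym (stackOnto-other C (embed S a) (embed S b) r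
                             (≢-sym (embed≢root S a)) (≢-sym (embed≢root S b))))
              root-occupied
    }

  tracks-to-root : ∀ a → Tracks S C₀ (vacate L a) (stackOnto C (embed S a) r)
  tracks-to-root a = record
    { on-subcube    = stackOnto-image-outside (embed-injective S) on-subcube (embed≢root S) a
    ; off-subcube   = λ w out w≢r →
        trans (stackOnto-other C (embed S a) r w (out a) w≢r) (off-subcube w out w≢r)
    ; root-occupied =
        subst (1 ≤_) (sym (stackOnto-target C (embed S a) r (≢-sym (embed≢root S a))))
              (≤-trans root-occupied (m≤m+n (C r) (C (embed S a))))
    }

  tracks-zero⇒cleared : (∀ x → L x ≡ 0) → Cleared S C₀ C
  tracks-zero⇒cleared L≗0 = record
    { subcube-emptied = λ x _ → trans (on-subcube x) (L≗0 x)
    ; off-subcube     = off-subcube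
    ; root-occupied   = root-occupied
    }

-- Vertices of Q^m are named by numbers whose binary digits, least significant first,
-- are their coordinates.
vertex : (m : ℕ) → ℕ → Vertex m
vertex zero    n = []
vertex (suc m) n = (n % 2 ≡ᵇ 1) ∷ vertex m ⌊ n /2⌋

infix 6 _⇒_ _⇒root

data LocalMove : Set where
  _⇒_    : ℕ → ℕ → LocalMove
  _⇒root : ℕ → LocalMove

-- A sequence of moves emptying a copy of Q^m at height t, as seen from inside the copy:
-- L is the configuration on the copy, and a move to the root only removes cups from it.
data Cleanup {m : ℕ} (t : ℕ) : Config m → List LocalMove → Set where
  done   : ∀ {L} → (∀ x → L x ≡ 0) → Cleanup t L []
  within : ∀ {L u v ms} (let a = vertex m u) (let b = vertex m v) →
           a ≢ b → 1 ≤ L a → 1 ≤ L b → dist a b ≡ L a →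
           Cleanup t (stackOnto L a b) ms → Cleanup t L (u ⇒ v ∷ ms)
  toRoot : ∀ {L u ms} (let a = vertex m u) →
           t + weight a ≡ L a → Cleanup t (vacate L a) ms → Cleanup t L (u ⇒root ∷ ms)

cleanup? : ∀ m t (L : Config m) ms → Maybe (Cleanup t L ms)
cleanup? m t L [] = Maybe.map done (dec⇒maybe (∀-vertex? (λ x → L x ℕ.≟ 0)))
cleanup? m t L (u ⇒ v ∷ ms) =
  Maybe.zipWith (λ (a≢b , La≥1 , Lb≥1 , dist≡La) → within a≢b La≥1 Lb≥1 dist≡La)
    (dec⇒maybe (¬? (a ≟ b) ×-dec 1 ≤? L a ×-dec 1 ≤? L b ×-dec dist a b ℕ.≟ L a))
    (cleanup? m t (stackOnto L a b) ms)
  where a = vertex m u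
        b = vertex m v
cleanup? m t L (u ⇒root ∷ ms) =
  Maybe.zipWith toRoot (dec⇒maybe (t + weight a ℕ.≟ L a)) (cleanup? m t (vacate L a) ms)
  where a = vertex m u

run-cleanup : {r : Vertex d} (S : Subcube r m (suc t)) {L : Config m} {ms : List LocalMove}
              {C₀ C : Config d} → Cleanup (suc t) L ms → Tracks S C₀ L C →
              ∃ λ C' → Star Move C C' × Cleared S C₀ C'
run-cleanup S (done L≗0) tracks = _ , ε , tracks-zero⇒cleared S tracks L≗0
run-cleanup S (within {u = u} {v} a≢b La≥1 Lb≥1 dist≡La rest) tracks
  with run-cleanup S rest (tracks-within S tracks (vertex _ u) (vertex _ v))
... | C' , steps , cleared = C' , step-within S tracks a≢b La≥1 Lb≥1 dist≡La ◅ steps , cleared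
run-cleanup S (toRoot {u = u} height≡La rest) tracks
  with run-cleanup S rest (tracks-to-root S tracks (vertex _ u))
... | C' , steps , cleared = C' , step-to-root S tracks height≡La ◅ steps , cleared

-- Clearable m t: the cups on any cube of dimension m at height t, one on each vertex other
-- than the root, can be moved onto an occupied root without touching any other vertex.
data Clearable : ℕ → ℕ → Set where
  point     : Clearable 0 0
  certified : ∀ {m t ms} → Cleanup (suc t) (initial {m}) ms → Clearable m (suc t)
  split     : ∀ {m t} → Clearable m t → Clearable m (suc t) → Clearable (suc m) t

open Cleared

cleared-faces : {r : Vertex d} (S : Subcube r (suc m) t) {C C₁ C₂ : Config d} →
                Cleared (lowerFace S) C C₁ → Cleared (upperFace S) C₁ C₂ → Cleared S C C₂
cleared-faces S cleared₁ cleared₂ = record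
  { subcube-emptied = λ
      { (false ∷ x) e≢r → trans (off-subcube cleared₂ _ (λ y → ≢-sym (faces-disjoint S y x)) e≢r)
                                (subcube-emptied cleared₁ x e≢r)
      ; (true ∷ x) → subcube-emptied cleared₂ x
      }
  ; off-subcube     = λ w out w≢r → trans (off-subcube cleared₂ w (λ x → out (true ∷ x)) w≢r)
                                          (off-subcube cleared₁ w (λ x → out (false ∷ x)) w≢r)
  ; root-occupied   = root-occupied cleared₂
  }

clear : {r : Vertex d} → Clearable m t → (S : Subcube r m t) (C : Config d) →
        (∀ x → embed S x ≢ r → C (embed S x) ≡ 1) → 1 ≤ C r →
        ∃ λ C' → Star Move C C' × Cleared S C C'
clear point S C _ root≥1 = C , ε , record
  { subcube-emptied = λ { [] e≢r → ⊥-elim (e≢r (dist≡0⇒≡ _ _ (dist-embed-root S []))) }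
  ; off-subcube     = λ _ _ _ → refl
  ; root-occupied   = root≥1
  }
clear (certified cleanup) S C ones root≥1 = run-cleanup S cleanup record
  { on-subcube    = λ x → ones x (embed≢root S x)
  ; off-subcube   = λ _ _ _ → refl
  ; root-occupied = root≥1
  }
clear (split lower upper) S C ones root≥1
  with clear lower (lowerFace S) C (λ x → ones (false ∷ x)) root≥1
... | C₁ , steps₁ , cleared₁
  with clear upper (upperFace S) C₁
         (λ x e≢r → trans (off-subcube cleared₁ _ (faces-disjoint S x) e≢r) (ones (true ∷ x) e≢r))
         (root-occupied cleared₁)
... | C₂ , steps₂ , cleared₂ = C₂ , steps₁ ◅◅ steps₂ , cleared-faces S cleared₁ cleared₂

stackable : Clearable d 0 → Stackable d
stackable c r with clear c (translation r) initial (λ _ _ → refl) (s≤s z≤n)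
... | C , steps , cleared = C , steps , λ w w≢r →
  subst (λ v → C v ≡ 0) (⊕-involutive r w)
        (subcube-emptied cleared (r ⊕ w) (λ eq → w≢r (trans (sym (⊕-involutive r w)) eq)))

checked : ∀ {m t} ms → {T (is-just (cleanup? m (suc t) initial ms))} → Clearable m (suc t)
checked {m} {t} ms {valid} = certified (to-witness-T (cleanup? m (suc t) initial ms) valid)

-- The cleanups of the small cubes were found by computer search.
certified? : ∀ m t → Maybe (Clearable m t)
certified? 0 0 = just point
certified? 0 1 = just $ checked
  (0 ⇒root ∷ [])
certified? 1 1 = just $ checked
  (0 ⇒ 1 ∷ 1 ⇒root ∷ [])
certified? 1 2 = just $ checked
  (1 ⇒ 0 ∷ 0 ⇒root ∷ [])
certified? 2 2 = just $ checked
  (1 ⇒ 3 ∷ 2 ⇒ 0 ∷ 0 ⇒ 3 ∷ 3 ⇒root ∷ [])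
certified? 2 3 = just $ checked
  (3 ⇒ 2 ∷ 2 ⇒ 1 ∷ 0 ⇒ 1 ∷ 1 ⇒root ∷ [])
certified? 2 4 = just $ checked
  (1 ⇒ 3 ∷ 3 ⇒ 0 ∷ 2 ⇒ 0 ∷ 0 ⇒root ∷ [])
certified? 3 5 = just $ checked
  (5 ⇒ 1 ∷ 6 ⇒ 7 ∷ 1 ⇒ 7 ∷ 3 ⇒ 7 ∷ 2 ⇒ 0 ∷ 4 ⇒ 0 ∷ 0 ⇒ 7 ∷ 7 ⇒root ∷ [])
certified? 3 6 = just $ checked
  (5 ⇒ 1 ∷ 2 ⇒ 6 ∷ 7 ⇒ 6 ∷ 4 ⇒ 0 ∷ 0 ⇒ 6 ∷ 3 ⇒ 1 ∷ 1 ⇒ 6 ∷ 6 ⇒root ∷ [])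
certified? 3 7 = just $ checked
  (5 ⇒ 1 ∷ 6 ⇒ 7 ∷ 3 ⇒ 2 ∷ 1 ⇒ 2 ∷ 7 ⇒ 2 ∷ 0 ⇒ 4 ∷ 4 ⇒ 2 ∷ 2 ⇒root ∷ [])
certified? 3 8 = just $ checked
  (5 ⇒ 1 ∷ 4 ⇒ 6 ∷ 2 ⇒ 3 ∷ 3 ⇒ 0 ∷ 6 ⇒ 0 ∷ 1 ⇒ 7 ∷ 7 ⇒ 0 ∷ 0 ⇒root ∷ [])
certified? 4 3 = just $ checked
  (10 ⇒ 2 ∷ 14 ⇒ 12 ∷ 12 ⇒ 15 ∷ 2 ⇒ 4 ∷ 0 ⇒ 8 ∷ 4 ⇒ 15 ∷ 7 ⇒ 15 ∷ 15 ⇒root ∷ 5 ⇒ 1 ∷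
   3 ⇒ 11 ∷ 8 ⇒ 1 ∷ 1 ⇒root ∷ 11 ⇒ 13 ∷ 13 ⇒ 6 ∷ 6 ⇒ 9 ∷ 9 ⇒root ∷ [])
certified? 4 4 = just $ checked
  (7 ⇒ 5 ∷ 12 ⇒ 4 ∷ 14 ⇒ 10 ∷ 10 ⇒ 6 ∷ 3 ⇒ 11 ∷ 11 ⇒ 13 ∷ 9 ⇒ 8 ∷ 6 ⇒ 13 ∷ 15 ⇒ 13 ∷
   13 ⇒root ∷ 4 ⇒ 1 ∷ 8 ⇒ 1 ∷ 1 ⇒root ∷ 5 ⇒ 0 ∷ 2 ⇒ 0 ∷ 0 ⇒root ∷ [])
certified? 5 7 = just $ checked
  (14 ⇒ 12 ∷ 4 ⇒ 12 ∷ 15 ⇒ 7 ∷ 12 ⇒ 2 ∷ 28 ⇒ 24 ∷ 21 ⇒ 17 ∷ 25 ⇒ 24 ∷ 11 ⇒ 3 ∷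
   10 ⇒ 26 ∷ 24 ⇒ 1 ∷ 8 ⇒ 0 ∷ 23 ⇒ 31 ∷ 19 ⇒ 27 ∷ 16 ⇒ 17 ∷ 6 ⇒ 2 ∷ 17 ⇒ 2 ∷ 2 ⇒root ∷
   20 ⇒ 22 ∷ 30 ⇒ 22 ∷ 7 ⇒ 31 ∷ 13 ⇒ 9 ∷ 29 ⇒ 31 ∷ 3 ⇒ 9 ∷ 27 ⇒ 18 ∷ 26 ⇒ 22 ∷ 18 ⇒ 1 ∷
   5 ⇒ 1 ∷ 1 ⇒root ∷ 31 ⇒ 0 ∷ 0 ⇒root ∷ 22 ⇒ 9 ∷ 9 ⇒root ∷ [])
certified? 5 8 = just $ checked
  (21 ⇒ 20 ∷ 31 ⇒ 27 ∷ 19 ⇒ 3 ∷ 28 ⇒ 30 ∷ 22 ⇒ 23 ∷ 15 ⇒ 7 ∷ 7 ⇒ 1 ∷ 25 ⇒ 24 ∷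
   24 ⇒ 27 ∷ 26 ⇒ 30 ∷ 20 ⇒ 17 ∷ 14 ⇒ 6 ∷ 3 ⇒ 27 ∷ 0 ⇒ 8 ∷ 23 ⇒ 27 ∷ 17 ⇒ 13 ∷ 4 ⇒ 6 ∷
   6 ⇒ 1 ∷ 5 ⇒ 13 ∷ 9 ⇒ 1 ∷ 30 ⇒ 13 ∷ 18 ⇒ 2 ∷ 29 ⇒ 13 ∷ 8 ⇒ 1 ∷ 1 ⇒root ∷ 10 ⇒ 11 ∷
   11 ⇒ 13 ∷ 13 ⇒root ∷ 2 ⇒ 16 ∷ 16 ⇒ 12 ∷ 12 ⇒ 27 ∷ 27 ⇒root ∷ [])
certified? 5 9 = just $ checked
  (14 ⇒ 12 ∷ 4 ⇒ 12 ∷ 15 ⇒ 7 ∷ 12 ⇒ 2 ∷ 28 ⇒ 24 ∷ 21 ⇒ 17 ∷ 25 ⇒ 24 ∷ 11 ⇒ 3 ∷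
   10 ⇒ 26 ∷ 24 ⇒ 1 ∷ 8 ⇒ 0 ∷ 23 ⇒ 31 ∷ 19 ⇒ 27 ∷ 16 ⇒ 17 ∷ 6 ⇒ 2 ∷ 17 ⇒ 2 ∷ 0 ⇒ 18 ∷
   26 ⇒ 2 ∷ 2 ⇒root ∷ 27 ⇒ 29 ∷ 13 ⇒ 5 ∷ 18 ⇒ 1 ∷ 5 ⇒ 20 ∷ 20 ⇒ 1 ∷ 1 ⇒root ∷ 31 ⇒ 7 ∷
   29 ⇒ 7 ∷ 30 ⇒ 22 ∷ 3 ⇒ 9 ∷ 9 ⇒ 7 ∷ 22 ⇒ 7 ∷ 7 ⇒root ∷ [])
certified? 5 10 = just $ checked
  (11 ⇒ 9 ∷ 29 ⇒ 13 ∷ 23 ⇒ 7 ∷ 22 ⇒ 30 ∷ 21 ⇒ 20 ∷ 30 ⇒ 10 ∷ 9 ⇒ 0 ∷ 27 ⇒ 19 ∷ 13 ⇒ 4 ∷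
   10 ⇒ 4 ∷ 12 ⇒ 4 ∷ 7 ⇒ 4 ∷ 6 ⇒ 4 ∷ 24 ⇒ 28 ∷ 28 ⇒ 25 ∷ 5 ⇒ 4 ∷ 4 ⇒root ∷ 25 ⇒ 0 ∷
   8 ⇒ 0 ∷ 20 ⇒ 0 ∷ 16 ⇒ 0 ∷ 0 ⇒root ∷ 3 ⇒ 2 ∷ 14 ⇒ 15 ∷ 19 ⇒ 1 ∷ 31 ⇒ 15 ∷ 15 ⇒ 1 ∷
   17 ⇒ 1 ∷ 18 ⇒ 26 ∷ 2 ⇒ 26 ∷ 26 ⇒ 1 ∷ 1 ⇒root ∷ [])
certified? _ _ = nothing

clearable? : ∀ m t → Maybe (Clearable m t)
clearable? zero    t = certified? zero t
clearable? (suc m) t =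
  certified? (suc m) t <∣> Maybe.zipWith split (clearable? m t) (clearable? m (suc t))

clearable-below-16 : ∀ {d} → d < 16 → T (is-just (clearable? d 0))
clearable-below-16 = from-yes (allUpTo? (λ d → T? (is-just (clearable? d 0))) 16)

corollary26 : ∀ (d : ℕ) → d ≤ 15 → Stackable d
corollary26 d d≤15 = stackable (to-witness-T (clearable? d 0) (clearable-below-16 (s≤s d≤15)))
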